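{- For every integer $k\ge 1$ there exists a finite graph $G=(V,E)$ with a $2$-edge-coloring by red and blue such that each of the spanning subgraphs $G_{blue}=(V,E_{blue})$ and $G_{red}=(V,E_{red})$ is $k$-edge-connected, but $G$ has no spanning bipartite subgraph $H$ (i.e. the subgraph formed by all edges of $G$ between the two sets of some partition of $V$) for which both the spanning subgraph formed by the red edges of $H$ and the spanning subgraph formed by the blue edges of $H$ are connected.
   Context: $E_{red}$ and $E_{blue}$ denote the sets of red and blue edges of $G$, respectively. -}

module Defs where

open import Data.Nat using (ℕ; _<_)
open import Data.Fin using (Fin)
open import Data.Bool using (Bool)
open import Data.Maybe using (Maybe; just; nothing)
open import Data.Product using (_×_; _,_)
open import Data.Sum using (_⊎_)
open import Data.List using (List; length)
open import Data.List.Membership.Propositional using (_∈_)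
open import Relation.Nullary using (¬_)
open import Relation.Binary.PropositionalEquality using (_≡_)

data Colour : Set where
  red blue : Colour

-- A finite simple graph on vertex set Fin n together with a red/blue
-- edge colouring is encoded by  c : Fin n → Fin n → Maybe Colour :
-- c u v ≡ nothing  means u,v are non-adjacent,
-- c u v ≡ just col means uv is an edge of colour col.
ColouredGraph : ℕ → Set
ColouredGraph n = Fin n → Fin n → Maybe Colour

IsSimple : {n : ℕ} → ColouredGraph n → Set
IsSimple {n} c = ((u v : Fin n) → c u v ≡ c v u) × ((v : Fin n) → c v v ≡ nothing)

Adjacency : ℕ → Set₁
Adjacency n = Fin n → Fin n → Set

data Reach {n : ℕ} (A : Adjacency n) : Fin n → Fin n → Set where
  here : ∀ {u} → Reach A u u
  step : ∀ {u v w} → A u v → Reach A v w → Reach A u w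

Connected : {n : ℕ} → Adjacency n → Set
Connected {n} A = (u v : Fin n) → Reach A u v

Remove : {n : ℕ} → Adjacency n → List (Fin n × Fin n) → Adjacency n
Remove A F u v = A u v × ¬ (((u , v) ∈ F) ⊎ ((v , u) ∈ F))

EdgeConnected : {n : ℕ} → ℕ → Adjacency n → Set
EdgeConnected {n} k A =
  (F : List (Fin n × Fin n)) → length F < k → Connected (Remove A F)

ColourAdj : {n : ℕ} → ColouredGraph n → Colour → Adjacency n
ColourAdj c col u v = c u v ≡ just col

-- Spanning bipartite subgraph H determined by the partition of V given by
-- side : Fin n → Bool (all edges between the two classes); its
-- spanning subgraph of edges of colour col.
BipColourAdj : {n : ℕ} → ColouredGraph n → (Fin n → Bool) → Colour → Adjacency n
BipColourAdj c side col u v = (c u v ≡ just col) × ¬ (side u ≡ side v)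

{-# OPTIONS --safe #-}
-- Take two layers of m = 2k + 3 vertices (p , i), p : Bool, i : Fin m, join every two
-- distinct vertices, and colour the edge red if the endpoints differ in both coordinates
-- and blue if they differ in exactly one.  Fewer than k deleted edges touch fewer than 2k
-- indices, so two untouched indices t ≠ s remain, and in either colour every vertex still
-- reaches (false , t) in at most two steps through vertices of index t or s.
-- If the red edges of a cut connect all vertices then, since red edges also change the
-- layer, side u xor layer u is constant.  So every blue cut edge changes the layer too,
-- hence is a rung (p , i)(not p , i), and the blue cut edges never change the index.
module Submission where

open import Defs
open import Data.Nat using (ℕ; _≤_; _<_; _+_; suc)
open import Data.Nat.Properties using (+-suc; +-mono-<; +-monoʳ-<; <-≤-trans; <⇒≤; ≤-refl)
open import Data.Fin using (Fin; zero; suc; splitAt; _↑ˡ_; _↑ʳ_)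
open import Data.Fin.Properties using (_≟_; ¬∀⟶∃¬; pigeonhole; <⇒≢; splitAt-↑ˡ; splitAt-↑ʳ)
open import Data.Bool using (Bool; true; false; not; _xor_)
open import Data.Bool.Properties using (not-¬; ¬-not; not-involutive; not-distribˡ-xor)
  renaming (_≟_ to _≟ᵇ_)
open import Data.Maybe using (Maybe; just; nothing)
open import Data.Product using (Σ; ∃; _×_; _,_)
open import Data.Sum using ([_,_]′; reduce; swap)
open import Data.List using (List; []; _∷_; length; map; lookup)
open import Data.List.Properties using (length-map)
open import Data.List.Membership.Propositional using (_∈_; _∉_)
open import Data.List.Membership.Propositional.Properties using (∈-map⁺)
import Data.List.Membership.DecPropositional as DecMembership
open import Data.List.Relation.Unary.Any using (here; there)
import Data.List.Relation.Unary.Any as Any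
open import Data.List.Relation.Unary.Any.Properties using (lookup-index)
open import Function using (_∘_; const)
open import Relation.Nullary using (¬_; Dec; yes; no; does; contradiction)
open import Relation.Nullary.Decidable using (dec-true; dec-false)
open import Relation.Binary.Definitions using (Symmetric; DecidableEquality)
open import Relation.Binary.PropositionalEquality

module _ {n : ℕ} {A : Adjacency n} where

  Reach-trans : ∀ {u v w} → Reach A u v → Reach A v w → Reach A u w
  Reach-trans here       q = q
  Reach-trans (step a p) q = step a (Reach-trans p q)

  Reach-reverse : Symmetric A → ∀ {u v} → Reach A u v → Reach A v u
  Reach-reverse A-sym here       = here
  Reach-reverse A-sym (step a p) = Reach-trans (Reach-reverse A-sym p) (step (A-sym a) here)

  Reach-constant : ∀ {B : Set} (f : Fin n → B) → (∀ {u v} → A u v → f u ≡ f v) →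
                   ∀ {u v} → Reach A u v → f u ≡ f v
  Reach-constant f f-edge here       = refl
  Reach-constant f f-edge (step a p) = trans (f-edge a) (Reach-constant f f-edge p)

  Connected-if-common-target : Symmetric A →
    (∀ u v → ∃ λ w → Reach A u w × Reach A v w) → Connected A
  Connected-if-common-target A-sym common u v with common u v
  ... | w , u⇝w , v⇝w = Reach-trans u⇝w (Reach-reverse A-sym v⇝w)

ColourAdj-symmetric : ∀ {n} {c : ColouredGraph n} {col} → IsSimple c → Symmetric (ColourAdj c col)
ColourAdj-symmetric (c-sym , _) {u} {v} uv = trans (c-sym v u) uv

endpoints : {A : Set} → List (A × A) → List A
endpoints []            = []
endpoints ((u , v) ∷ F) = u ∷ v ∷ endpoints F

length-endpoints : {A : Set} (F : List (A × A)) → length (endpoints F) ≡ length F + length F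
length-endpoints []      = refl
length-endpoints (_ ∷ F) =
  cong suc (trans (cong suc (length-endpoints F)) (sym (+-suc (length F) (length F))))

∈-endpointsˡ : ∀ {A : Set} {F : List (A × A)} {u v} → (u , v) ∈ F → u ∈ endpoints F
∈-endpointsˡ (here refl) = here refl
∈-endpointsˡ (there p)   = there (there (∈-endpointsˡ p))

∈-endpointsʳ : ∀ {A : Set} {F : List (A × A)} {u v} → (u , v) ∈ F → v ∈ endpoints F
∈-endpointsʳ (here refl) = there (here refl)
∈-endpointsʳ (there p)   = there (there (∈-endpointsʳ p))

module _ {n : ℕ} {A : Adjacency n} {F : List (Fin n × Fin n)} where

  Remove-symmetric : Symmetric A → Symmetric (Remove A F)
  Remove-symmetric A-sym (a , a∉F) = A-sym a , a∉F ∘ swap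

  Remove-untouched : ∀ {u v} → A u v → v ∉ endpoints F → Remove A F u v
  Remove-untouched a v∉ = a , [ v∉ ∘ ∈-endpointsʳ , v∉ ∘ ∈-endpointsˡ ]′

fresh : ∀ {m} (L : List (Fin m)) → length L < m → ∃ λ t → t ∉ L
fresh {m} L |L|<m = ¬∀⟶∃¬ m (_∈ L) (_∈? L) not-all-in
  where
  open DecMembership (_≟_ {m}) using (_∈?_)
  not-all-in : ¬ (∀ t → t ∈ L)
  not-all-in all-in with pigeonhole |L|<m (Any.index ∘ all-in)
  ... | i , j , i<j , same-position = <⇒≢ i<j (begin
    i                                ≡⟨ lookup-index (all-in i) ⟩
    lookup L (Any.index (all-in i))  ≡⟨ cong (lookup L) same-position ⟩
    lookup L (Any.index (all-in j))  ≡⟨ lookup-index (all-in j) ⟨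
    j                                ∎)
    where open ≡-Reasoning

does-≟-sym : {A : Set} (_≟A_ : DecidableEquality A) → ∀ x y → does (x ≟A y) ≡ does (y ≟A x)
does-≟-sym _≟A_ x y with x ≟A y | y ≟A x
... | yes _   | yes _   = refl
... | no _    | no _    = refl
... | yes x≡y | no y≢x  = contradiction (sym x≡y) y≢x
... | no x≢y  | yes y≡x = contradiction (sym y≡x) x≢y

≡-not⇒≢ : ∀ {x y} → x ≡ not y → x ≢ y
≡-not⇒≢ x≡not-y x≡y = not-¬ x≡y x≡not-y

not-xor-not : ∀ x y → not x xor not y ≡ x xor y
not-xor-not false y = not-involutive y
not-xor-not true  y = refl

xor-≢ : ∀ {a b c d} → a ≢ b → c ≢ d → a xor c ≡ b xor d
xor-≢ {b = b} {d = d} a≢b c≢d = trans (cong₂ _xor_ (¬-not a≢b) (¬-not c≢d)) (not-xor-not b d)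

xor-≡⇒≢ : ∀ {a b c d} → a xor c ≡ b xor d → a ≢ b → c ≢ d
xor-≡⇒≢ {b = b} {c = c} eq a≢b refl =
  not-¬ refl (sym (trans (not-distribˡ-xor b c) (trans (cong (_xor c) (sym (¬-not a≢b))) eq)))

colourOf : (sameLayer sameIndex : Bool) → Maybe Colour
colourOf true  true  = nothing
colourOf true  false = just blue
colourOf false true  = just blue
colourOf false false = just red

colourOf-red⇒¬ : ∀ {A B : Set} (a? : Dec A) (b? : Dec B) →
                 colourOf (does a?) (does b?) ≡ just red → ¬ A
colourOf-red⇒¬ (no ¬a) _       _  = ¬a
colourOf-red⇒¬ (yes _) (yes _) ()
colourOf-red⇒¬ (yes _) (no _)  ()

colourOf-blue-¬⇒ : ∀ {A B : Set} (a? : Dec A) (b? : Dec B) →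
                   colourOf (does a?) (does b?) ≡ just blue → ¬ A → B
colourOf-blue-¬⇒ (yes a) _       _  ¬a = contradiction a ¬a
colourOf-blue-¬⇒ (no _)  (yes b) _  _  = b
colourOf-blue-¬⇒ (no _)  (no _)  ()

module DoubledClique (m : ℕ) where

  Vertex : Set
  Vertex = Fin (m + m)

  layer : Vertex → Bool
  layer v = [ const false , const true ]′ (splitAt m v)

  index : Vertex → Fin m
  index v = reduce (splitAt m v)

  -- Opaque, so that the unifier recovers p from vertex p t instead of unfolding it.
  opaque
    vertex : Bool → Fin m → Vertex
    vertex false i = i ↑ˡ m
    vertex true  i = m ↑ʳ i

    layer-vertex : ∀ p i → layer (vertex p i) ≡ p
    layer-vertex false i = cong [ const false , const true ]′ (splitAt-↑ˡ m i m)
    layer-vertex true  i = cong [ const false , const true ]′ (splitAt-↑ʳ m m i)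

    index-vertex : ∀ p i → index (vertex p i) ≡ i
    index-vertex false i = cong reduce (splitAt-↑ˡ m i m)
    index-vertex true  i = cong reduce (splitAt-↑ʳ m m i)

  colouring : ColouredGraph (m + m)
  colouring u v = colourOf (does (layer u ≟ᵇ layer v)) (does (index u ≟ index v))

  colouring-simple : IsSimple colouring
  colouring-simple =
    (λ u v → cong₂ colourOf (does-≟-sym _≟ᵇ_ (layer u) (layer v))
                            (does-≟-sym _≟_ (index u) (index v))) ,
    (λ v → cong₂ colourOf (dec-true (layer v ≟ᵇ layer v) refl)
                          (dec-true (index v ≟ index v) refl))

  colouring-vertex : ∀ u p t →
    colouring u (vertex p t) ≡ colourOf (does (layer u ≟ᵇ p)) (does (index u ≟ t))
  colouring-vertex u p t =
    cong₂ (λ q j → colourOf (does (layer u ≟ᵇ q)) (does (index u ≟ j)))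
          (layer-vertex p t) (index-vertex p t)

  module _ {u : Vertex} {p : Bool} {t : Fin m} where

    colouring-red : layer u ≡ not p → index u ≢ t → colouring u (vertex p t) ≡ just red
    colouring-red lu u≢t = trans (colouring-vertex u p t)
      (cong₂ colourOf (dec-false (layer u ≟ᵇ p) (≡-not⇒≢ lu)) (dec-false (index u ≟ t) u≢t))

    colouring-blue-within : layer u ≡ p → index u ≢ t → colouring u (vertex p t) ≡ just blue
    colouring-blue-within lu u≢t = trans (colouring-vertex u p t)
      (cong₂ colourOf (dec-true (layer u ≟ᵇ p) lu) (dec-false (index u ≟ t) u≢t))

    colouring-blue-across : layer u ≡ not p → index u ≡ t → colouring u (vertex p t) ≡ just blue
    colouring-blue-across lu u≡t = trans (colouring-vertex u p t)
      (cong₂ colourOf (dec-false (layer u ≟ᵇ p) (≡-not⇒≢ lu)) (dec-true (index u ≟ t) u≡t))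

  touched : List (Vertex × Vertex) → List (Fin m)
  touched F = map index (endpoints F)

  touched-bound : ∀ {k} (F : List (Vertex × Vertex)) → length F < k →
                  3 + length (touched F) < 3 + (k + k)
  touched-bound F |F|<k rewrite length-map index (endpoints F) | length-endpoints F =
    +-monoʳ-< 3 (+-mono-< |F|<k |F|<k)

  vertex-untouched : ∀ {F p t} → t ∉ touched F → vertex p t ∉ endpoints F
  vertex-untouched {F} {p} {t} t∉ v∈ =
    t∉ (subst (_∈ touched F) (index-vertex p t) (∈-map⁺ index v∈))

  Survivors : List (Vertex × Vertex) → Colour → Adjacency (m + m)
  Survivors F col = Remove (ColourAdj colouring col) F

  survives : ∀ {F col u p t} → t ∉ touched F → colouring u (vertex p t) ≡ just col →
             Survivors F col u (vertex p t)
  survives {col = col} t∉ uv =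
    Remove-untouched {A = ColourAdj colouring col} uv (vertex-untouched t∉)

  module _ (F : List (Vertex × Vertex)) {t s : Fin m}
           (t∉ : t ∉ touched F) (s∉ : s ∉ touched F) (s≢t : s ≢ t) where

    reach-hub : ∀ col u → index u ≢ t → index u ≢ s → Reach (Survivors F col) u (vertex false t)
    reach-hub red u u≢t u≢s with layer u in lu
    ... | true  = step (survives t∉ (colouring-red lu u≢t)) here
    ... | false = step (survives s∉ (colouring-red lu u≢s))
                 (step (survives t∉ (colouring-red (layer-vertex true s) s′≢t)) here)
      where
      s′≢t : index (vertex true s) ≢ t
      s′≢t = subst (_≢ t) (sym (index-vertex true s)) s≢t
    reach-hub blue u u≢t _ with layer u in lu
    ... | false = step (survives t∉ (colouring-blue-within lu u≢t)) here
    ... | true  = step (survives t∉ (colouring-blue-within lu u≢t))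
                 (step (survives t∉ rung) here)
      where
      rung : colouring (vertex true t) (vertex false t) ≡ just blue
      rung = colouring-blue-across (layer-vertex true t) (index-vertex true t)

  edge-connected : ∀ {k} → 3 + (k + k) ≤ m → ∀ col → EdgeConnected k (ColourAdj colouring col)
  edge-connected 3+2k≤m col F |F|<k =
    Connected-if-common-target (Remove-symmetric (ColourAdj-symmetric colouring-simple)) common
    where
    room : 3 + length (touched F) < m
    room = <-≤-trans (touched-bound F |F|<k) 3+2k≤m
    common : ∀ u v → ∃ λ w → Reach (Survivors F col) u w × Reach (Survivors F col) v w
    common u v with fresh (index u ∷ index v ∷ touched F) (<⇒≤ room)
    ... | t , t∉ with fresh (t ∷ index u ∷ index v ∷ touched F) room
    ... | s , s∉ =
      vertex false t ,
      hub u (t∉ ∘ here ∘ sym) (s∉ ∘ there ∘ here ∘ sym) ,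
      hub v (t∉ ∘ there ∘ here ∘ sym) (s∉ ∘ there ∘ there ∘ here ∘ sym)
      where
      hub : ∀ w → index w ≢ t → index w ≢ s → Reach (Survivors F col) w (vertex false t)
      hub = reach-hub F (t∉ ∘ there ∘ there) (s∉ ∘ there ∘ there ∘ there) (s∉ ∘ here) col

  module _ (side : Vertex → Bool) where

    parity : Vertex → Bool
    parity u = side u xor layer u

    red-cut-keeps-parity : ∀ {u v} → BipColourAdj colouring side red u v → parity u ≡ parity v
    red-cut-keeps-parity {u} {v} (uv-red , side≢) =
      xor-≢ side≢ (colourOf-red⇒¬ (layer u ≟ᵇ layer v) (index u ≟ index v) uv-red)

    blue-cut-keeps-index : (∀ u v → parity u ≡ parity v) →
      ∀ {u v} → BipColourAdj colouring side blue u v → index u ≡ index v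
    blue-cut-keeps-index parity-constant {u} {v} (uv-blue , side≢) =
      colourOf-blue-¬⇒ (layer u ≟ᵇ layer v) (index u ≟ index v) uv-blue
        (xor-≡⇒≢ (parity-constant u v) side≢)

    no-bicoloured-connected-cut : ∀ {i j : Fin m} → i ≢ j →
      ¬ (Connected (BipColourAdj colouring side red) × Connected (BipColourAdj colouring side blue))
    no-bicoloured-connected-cut {i} {j} i≢j (red-connected , blue-connected) = i≢j (begin
      i                      ≡⟨ index-vertex false i ⟨
      index (vertex false i) ≡⟨ index-constant (vertex false i) (vertex false j) ⟩
      index (vertex false j) ≡⟨ index-vertex false j ⟩
      j                      ∎)
      where
      open ≡-Reasoning
      parity-constant : ∀ u v → parity u ≡ parity v
      parity-constant u v = Reach-constant parity red-cut-keeps-parity (red-connected u v)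
      index-constant : ∀ u v → index u ≡ index v
      index-constant u v =
        Reach-constant index (blue-cut-keeps-index parity-constant) (blue-connected u v)

-- The construction works for k = 0 as well.
mainTheorem10 : (k : ℕ) → 1 ≤ k →
    Σ ℕ λ n → Σ (ColouredGraph n) λ c →
      IsSimple c
      × EdgeConnected k (ColourAdj c red)
      × EdgeConnected k (ColourAdj c blue)
      × ((side : Fin n → Bool) →
          ¬ (Connected (BipColourAdj c side red) × Connected (BipColourAdj c side blue)))
mainTheorem10 k _ =
  m + m , colouring , colouring-simple , edge-connected ≤-refl red , edge-connected ≤-refl blue ,
  λ side → no-bicoloured-connected-cut side {zero} {suc zero} λ ()
  where
  m : ℕ
  m = 3 + (k + k)
  open DoubledClique m
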